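{- Let $p_1<p_2<p_3$ be odd primes with $p_2\equiv 1 \pmod{p_1}$ and $p_3\equiv 1\pmod{p_1p_2}$, let $q_2=(p_2-1)/p_1$, and let $0\le i_1\le p_1-2$, $0\le i_2\le q_2-1$, $0\le i_3\le p_1-1$ be integers. Define $$g_i=\begin{cases} +x^{i_1p_2+i_2p_1+1}\sum_{k=0}^{p_1-2-i_1}x^k & \text{if } i_3\le i_1,\\ -x^{i_1(p_2-1)+(i_2+1)p_1}\sum_{k=0}^{i_1}x^k & \text{if } i_3>i_1,\end{cases}$$ and consider the expression $f_i=S_1+S_2+S_3+S_4$ with $S_1=1$, $S_2=g_i$, $S_3=-x^{(i_1+1)p_2}$, $S_4=-x^{p_2}g_i$. Then for $j=1,2,3$ the lowest degree of a term of $S_{j+1}$ is strictly greater than $\deg S_j$. Consequently, when $f_i$ is written as the list of monomials $1$, the monomials of $g_i$ (one per $k$), $-x^{(i_1+1)p_2}$, and the monomials of $-x^{p_2}g_i$ (one per $k$), no two of these monomials have the same exponent and the exponents appear in strictly ascending order. -}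

module Defs where

open import Data.Nat using (ℕ; suc; _+_; _*_; _∸_; _≤?_)
open import Data.Integer as ℤ using (ℤ; +_; -[1+_])
open import Data.List using (List; []; _∷_; map; upTo; _++_)
open import Data.Product using (_×_; _,_; proj₁; proj₂)
open import Relation.Nullary using (yes; no)

-- A signed monomial  c · x^e  is represented by the pair (c , e).
Monomial : Set
Monomial = ℤ × ℕ

coeff : Monomial → ℤ
coeff = proj₁

expo : Monomial → ℕ
expo = proj₂

Poly : Set
Poly = List Monomial

g : ℕ → ℕ → ℕ → ℕ → ℕ → Poly
g p1 p2 i1 i2 i3 with i3 ≤? i1
... | yes _ = map (λ k → (+ 1 , i1 * p2 + i2 * p1 + 1 + k)) (upTo (suc (p1 ∸ 2 ∸ i1)))
... | no  _ = map (λ k → (-[1+ 0 ] , i1 * (p2 ∸ 1) + (i2 + 1) * p1 + k)) (upTo (suc i1))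

S₁ : Poly
S₁ = (+ 1 , 0) ∷ []

S₂ : ℕ → ℕ → ℕ → ℕ → ℕ → Poly
S₂ = g

S₃ : ℕ → ℕ → Poly
S₃ p2 i1 = (-[1+ 0 ] , (i1 + 1) * p2) ∷ []

S₄ : ℕ → ℕ → ℕ → ℕ → ℕ → Poly
S₄ p1 p2 i1 i2 i3 = map (λ m → (ℤ.- coeff m , p2 + expo m)) (g p1 p2 i1 i2 i3)

f : ℕ → ℕ → ℕ → ℕ → ℕ → Poly
f p1 p2 i1 i2 i3 = S₁ ++ S₂ p1 p2 i1 i2 i3 ++ S₃ p2 i1 ++ S₄ p1 p2 i1 i2 i3

-- Write p₂ = q₂ p₁ + 1. In both cases g_i is a run of consecutive exponents, and the
-- bounds i₁ ≤ p₁ − 2, i₂ < q₂ place the whole run strictly between i₁ p₂ and (i₁ + 1) p₂.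
-- Hence the exponents of 1, g_i, x^((i₁+1)p₂) and x^p₂ g_i occupy the disjoint, increasing
-- ranges {0}, (i₁p₂, (i₁+1)p₂), {(i₁+1)p₂} and ((i₁+1)p₂, (i₁+2)p₂).

module Submission where

open import Defs
open import Data.Nat using (ℕ; suc; _+_; _*_; _∸_; _<_; _≤_; z≤n; s≤s; z<s; _≤?_)
open import Data.Nat.Base using (nonTrivial⇒n>1)
open import Data.Nat.Primality using (Prime; prime⇒nonTrivial)
open import Data.Nat.Divisibility using (_∣_)
open import Data.Nat.Properties
open import Data.Nat.Tactic.RingSolver using (solve-∀)
open import Data.Integer as ℤ using (ℤ)
open import Data.List using (map; upTo; _++_)
open import Data.List.Relation.Unary.All as All using (All; []; _∷_)
import Data.List.Relation.Unary.All.Properties as All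
open import Data.List.Relation.Unary.AllPairs as AllPairs using (AllPairs; []; _∷_)
import Data.List.Relation.Unary.AllPairs.Properties as AllPairs
open import Data.List.Relation.Unary.Linked using (Linked)
open import Data.List.Relation.Unary.Linked.Properties using (AllPairs⇒Linked)
open import Data.Product using (_×_; _,_)
open import Function using (id; _on_)
open import Relation.Nullary using (¬_; yes; no)
open import Relation.Binary.PropositionalEquality using (_≡_; _≢_; refl; sym; trans; cong)

Sorted : Poly → Set
Sorted = AllPairs (_<_ on expo)

infix 4 _≺_

_≺_ : Poly → Poly → Set
xs ≺ ys = All (λ m → All (λ m′ → expo m < expo m′) ys) xs

Below AtLeast : ℕ → Poly → Set
Below b = All (λ m → expo m < b)
AtLeast b = All (λ m → b ≤ expo m)

Between : ℕ → ℕ → Monomial → Set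
Between lo hi m = lo < expo m × expo m < hi

separated⇒≺ : ∀ {b xs ys} → Below b xs → AtLeast b ys → xs ≺ ys
separated⇒≺ xs<b b≤ys = All.map (λ x<b → All.map (<-≤-trans x<b) b≤ys) xs<b

sorted-++ : ∀ {b xs ys} → Below b xs → AtLeast b ys → Sorted xs → Sorted ys → Sorted (xs ++ ys)
sorted-++ xs<b b≤ys sxs sys = AllPairs.++⁺ sxs sys (separated⇒≺ xs<b b≤ys)

AtLeast-weaken : ∀ {a b xs} → a ≤ b → AtLeast b xs → AtLeast a xs
AtLeast-weaken a≤b = All.map (≤-trans a≤b)

progression : ℤ → ℕ → ℕ → Poly
progression c a n = map (λ k → (c , a + k)) (upTo n)

progression-sorted : ∀ c a n → Sorted (progression c a n)
progression-sorted c a n =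
  AllPairs.map⁺ (AllPairs.applyUpTo⁺₁ id n (λ i<j _ → +-monoʳ-< a i<j))

progression-between : ∀ {lo hi} c a n → lo < a → a + n ≤ hi → All (Between lo hi) (progression c a n)
progression-between c a n lo<a a+n≤hi =
  All.map⁺ (All.applyUpTo⁺₁ id n (λ {k} k<n →
    <-≤-trans lo<a (m≤m+n a k) , <-≤-trans (+-monoʳ-< a k<n) a+n≤hi))

g-sorted : ∀ p₁ p₂ i₁ i₂ i₃ → Sorted (g p₁ p₂ i₁ i₂ i₃)
g-sorted p₁ p₂ i₁ i₂ i₃ with i₃ ≤? i₁
... | yes _ = progression-sorted _ _ _
... | no  _ = progression-sorted _ _ _

[m+1]*n≡n+m*n : ∀ m n → (m + 1) * n ≡ n + m * n
[m+1]*n≡n+m*n = solve-∀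

m<n∧k≤o⇒k+m*o≤n*o : ∀ {m n k o} → m < n → k ≤ o → k + m * o ≤ n * o
m<n∧k≤o⇒k+m*o≤n*o {m} {o = o} m<n k≤o = ≤-trans (+-monoˡ-≤ (m * o) k≤o) (*-monoˡ-≤ o m<n)

g-between : ∀ {p₁ q₂ i₁ i₂} i₃ → let p₂ = suc (q₂ * p₁) in
  1 < p₁ → i₁ ≤ p₁ ∸ 2 → i₂ < q₂ →
  All (Between (i₁ * p₂) (i₁ * p₂ + p₂)) (g p₁ p₂ i₁ i₂ i₃)
g-between {p₁ = p₁@(suc (suc p))} {q₂} {i₁} {i₂} i₃ (s≤s (s≤s z≤n)) i₁≤p i₂<q₂ with i₃ ≤? i₁
... | yes _ = progression-between _ _ _ lo<a a+n≤hi
  where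
  open ≤-Reasoning
  lo = i₁ * suc (q₂ * p₁)
  d = p ∸ i₁
  lo<a : lo < lo + i₂ * p₁ + 1
  lo<a = ≤-<-trans (m≤m+n lo (i₂ * p₁)) (m<m+n _ z<s)
  a+n≤hi : lo + i₂ * p₁ + 1 + suc d ≤ lo + suc (q₂ * p₁)
  a+n≤hi = begin
    lo + i₂ * p₁ + 1 + suc d   ≡⟨ shuffle lo (i₂ * p₁) d ⟩
    lo + suc (suc d + i₂ * p₁) ≤⟨ +-monoʳ-≤ lo (s≤s (m<n∧k≤o⇒k+m*o≤n*o i₂<q₂ (s≤s (m≤n⇒m≤1+n (m∸n≤m p i₁))))) ⟩
    lo + suc (q₂ * p₁)         ∎
    where
    shuffle : ∀ l x d → l + x + 1 + suc d ≡ l + suc (suc d + x)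
    shuffle = solve-∀
... | no  _ = progression-between _ _ _ lo<a a+n≤hi
  where
  open ≤-Reasoning
  m = q₂ * p₁
  lo<a : i₁ * suc m < i₁ * m + (i₂ + 1) * p₁
  lo<a = begin-strict
    i₁ * suc m              ≡⟨ trans (*-suc i₁ m) (+-comm i₁ (i₁ * m)) ⟩
    i₁ * m + i₁             <⟨ +-monoʳ-< (i₁ * m) (<-≤-trans (s≤s (m≤n⇒m≤1+n i₁≤p)) (m≤m+n p₁ (i₂ * p₁))) ⟩
    i₁ * m + (p₁ + i₂ * p₁) ≡⟨ cong (i₁ * m +_) (sym ([m+1]*n≡n+m*n i₂ p₁)) ⟩
    i₁ * m + (i₂ + 1) * p₁  ∎
  a+n≤hi : i₁ * m + (i₂ + 1) * p₁ + suc i₁ ≤ i₁ * suc m + suc m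
  a+n≤hi = begin
    i₁ * m + (i₂ + 1) * p₁ + suc i₁ ≡⟨ shuffle i₁ m i₂ p₁ ⟩
    i₁ * suc m + suc (p₁ + i₂ * p₁) ≤⟨ +-monoʳ-≤ (i₁ * suc m) (s≤s (m<n∧k≤o⇒k+m*o≤n*o i₂<q₂ ≤-refl)) ⟩
    i₁ * suc m + suc m              ∎
    where
    shuffle : ∀ i m j p → i * m + (j + 1) * p + suc i ≡ i * suc m + suc (p + j * p)
    shuffle = solve-∀

module Blocks {p₂ i₁ : ℕ} {G : Poly} (0<p₂ : 0 < p₂) (G-sorted : Sorted G)
              (G-between : All (Between (i₁ * p₂) (i₁ * p₂ + p₂)) G) where

  B : ℕ
  B = (i₁ + 1) * p₂

  S₄′ : Poly
  S₄′ = map (λ m → (ℤ.- coeff m , p₂ + expo m)) G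

  B≡p₂+i₁p₂ : B ≡ p₂ + i₁ * p₂
  B≡p₂+i₁p₂ = [m+1]*n≡n+m*n i₁ p₂

  G<B : Below B G
  G<B = All.map (λ (_ , e<hi) → <-≤-trans e<hi (≤-reflexive (trans (+-comm (i₁ * p₂) p₂) (sym B≡p₂+i₁p₂)))) G-between

  B<S₄ : AtLeast (suc B) S₄′
  B<S₄ = All.map⁺ (All.map (λ (lo<e , _) → ≤-trans (≤-reflexive (cong suc B≡p₂+i₁p₂)) (+-monoʳ-< p₂ lo<e)) G-between)

  0<B : 0 < B
  0<B = ≤-trans 0<p₂ (≤-trans (m≤m+n p₂ (i₁ * p₂)) (≤-reflexive (sym B≡p₂+i₁p₂)))

  S₄-sorted : Sorted S₄′
  S₄-sorted = AllPairs.map⁺ (AllPairs.map (+-monoʳ-< p₂) G-sorted)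

  G≥1 : AtLeast 1 G
  G≥1 = All.map (λ (lo<e , _) → ≤-trans (s≤s z≤n) lo<e) G-between

  S₁≺G : S₁ ≺ G
  S₁≺G = separated⇒≺ (≤-refl ∷ []) G≥1

  G≺S₃ : G ≺ S₃ p₂ i₁
  G≺S₃ = separated⇒≺ G<B (≤-refl ∷ [])

  S₃≺S₄ : S₃ p₂ i₁ ≺ S₄′
  S₃≺S₄ = separated⇒≺ (≤-refl ∷ []) B<S₄

  f-sorted : Sorted (S₁ ++ G ++ S₃ p₂ i₁ ++ S₄′)
  f-sorted = sorted-++ (≤-refl ∷ []) (All.++⁺ G≥1 (AtLeast-weaken 0<B B≤S₃S₄)) ([] ∷ [])
               (sorted-++ G<B B≤S₃S₄ G-sorted (sorted-++ (≤-refl ∷ []) B<S₄ ([] ∷ []) S₄-sorted))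
    where
    B≤S₃S₄ : AtLeast B (S₃ p₂ i₁ ++ S₄′)
    B≤S₃S₄ = ≤-refl ∷ AtLeast-weaken (n≤1+n B) B<S₄

lemma7 : (p₁ p₂ p₃ q₂ i₁ i₂ i₃ : ℕ) →
    Prime p₁ → Prime p₂ → Prime p₃ →
    ¬ (2 ∣ p₁) → ¬ (2 ∣ p₂) → ¬ (2 ∣ p₃) →
    p₁ < p₂ → p₂ < p₃ →
    p₁ ∣ (p₂ ∸ 1) → (p₁ * p₂) ∣ (p₃ ∸ 1) →
    q₂ * p₁ ≡ p₂ ∸ 1 →
    i₁ ≤ p₁ ∸ 2 → i₂ < q₂ → i₃ ≤ p₁ ∸ 1 →
    (All (λ m → All (λ m′ → expo m < expo m′) (S₂ p₁ p₂ i₁ i₂ i₃)) S₁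
     × All (λ m → All (λ m′ → expo m < expo m′) (S₃ p₂ i₁)) (S₂ p₁ p₂ i₁ i₂ i₃)
     × All (λ m → All (λ m′ → expo m < expo m′) (S₄ p₁ p₂ i₁ i₂ i₃)) (S₃ p₂ i₁))
    × AllPairs _≢_ (map expo (f p₁ p₂ i₁ i₂ i₃))
    × Linked _<_ (map expo (f p₁ p₂ i₁ i₂ i₃))
lemma7 p₁ p₂ _ q₂ i₁ i₂ i₃ p₁-prime _ _ _ _ _ p₁<p₂ _ _ _ q₂p₁≡p₂∸1 i₁≤p₁∸2 i₂<q₂ _
  with refl ← trans (sym (m+[n∸m]≡n (≤-trans (s≤s z≤n) p₁<p₂))) (cong suc (sym q₂p₁≡p₂∸1))
  = (S₁≺G , G≺S₃ , S₃≺S₄) , AllPairs.map <⇒≢ exponents-ascending , AllPairs⇒Linked exponents-ascending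
  where
  1<p₁ : 1 < p₁
  1<p₁ = nonTrivial⇒n>1 p₁ {{prime⇒nonTrivial p₁-prime}}
  open Blocks {i₁ = i₁} z<s (g-sorted p₁ p₂ i₁ i₂ i₃) (g-between i₃ 1<p₁ i₁≤p₁∸2 i₂<q₂)
  exponents-ascending : AllPairs _<_ (map expo (f p₁ p₂ i₁ i₂ i₃))
  exponents-ascending = AllPairs.map⁺ f-sorted
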